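{- Let $F$ and $G$ be clausal ground formulas (of first-order logic without equality) and let $N_0$ be the root of a leaf-closed two-sided clausal ground tableau for $F$ and $G$. Then (1) $F \models \mathrm{ipol}(N_0) \models \lnot G$, and (2) $\mathrm{lit}(\mathrm{ipol}(N_0)) \subseteq \mathrm{lit}(F) \cap \mathrm{lit}(\lnot G)$.
   Context: Formulas are first-order without equality, built from atoms, the constants $\top,\bot$, $\lnot$, $\land$, $\lor$, $\forall$, $\exists$. A literal is an atom or a negated atom; the complement $\overline{L}$ of $A$ is $\lnot A$ and of $\lnot A$ is $A$. A clause is a (possibly empty) disjunction of literals; a clausal formula is a (possibly empty) conjunction of clauses. A formula is ground if no variable occurs in it. A subformula occurrence has positive (negative) polarity if it lies in the scope of an even (odd) number of negations. $\mathrm{lit}(F)$ is the set of pairs $\langle A, pol\rangle$ with $A$ an atom and $pol\in\{+,-\}$ such that $A$ occurs in $F$ with polarity $pol$ (so $\mathrm{lit}(\top)=\mathrm{lit}(\bot)=\emptyset$). A clausal tableau for a clausal formula $K$ is a finite ordered tree whose nodes other than the root are labeled with a literal $\mathrm{lit}(N)$ such that for each node $N$ with children, the disjunction $\mathrm{clause}(N)$ of the labels of its children in left-to-right order is an instance of a clause of $K$. It is ground if all literal labels are ground. A node is closing if it has an ancestor with complementary literal; with each closing node $N$ one such ancestor is associated as its target $\mathrm{tgt}(N)$. A tableau is leaf-closed if all its leaves are closing. A two-sided clausal tableau for clausal formulas $F$ and $G$ is a clausal tableau for $F\land G$ whose non-root nodes $N$ carry in addition a side $\mathrm{side}(N)\in\{\mathsf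 F,\mathsf G\}$ such that siblings have the same side, and if the children of $N$ have side $\mathsf F$ then $\mathrm{clause}(N)$ is an instance of a clause of $F$, and if they have side $\mathsf G$ then $\mathrm{clause}(N)$ is an instance of a clause of $G$. For a node $N$ of a leaf-closed two-sided tableau, $\mathrm{ipol}(N)$ is defined inductively: if $N$ is a leaf, then $\mathrm{ipol}(N)=\bot$ if $\mathrm{side}(N)=\mathsf F$ and $\mathrm{side}(\mathrm{tgt}(N))=\mathsf F$; $\mathrm{ipol}(N)=\mathrm{lit}(N)$ if $\mathrm{side}(N)=\mathsf F$ and $\mathrm{side}(\mathrm{tgt}(N))=\mathsf G$; $\mathrm{ipol}(N)=\overline{\mathrm{lit}(N)}$ if $\mathrm{side}(N)=\mathsf G$ and $\mathrm{side}(\mathrm{tgt}(N))=\mathsf F$; $\mathrm{ipol}(N)=\top$ if both sides are $\mathsf G$. If $N$ is an inner node with children $N_1,\dots,N_n$ ($n\ge 1$), then $\mathrm{ipol}(N)=\bigvee_{i=1}^n \mathrm{ipol}(N_i)$ if the children have side $\mathsf F$, and $\mathrm{ipol}(N)=\bigwedge_{i=1}^n \mathrm{ipol}(N_i)$ if they have side $\mathsf G$. -}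

module Defs where

open import Data.Nat using (ℕ)
open import Data.Bool using (Bool; true; false; not; _∧_; _∨_)
open import Data.Vec using (Vec; []; _∷_)
open import Data.List using (List; []; _∷_; map)
open import Data.List.Membership.Propositional using (_∈_)
open import Data.List.Relation.Unary.Any using (Any)
open import Data.Product using (_×_; _,_; proj₁; proj₂)
open import Relation.Binary.PropositionalEquality using (_≡_)

record Signature : Set₁ where
  field
    Fun    : Set
    farity : Fun → ℕ
    Pred   : Set
    parity : Pred → ℕ

module FOL (Σ : Signature) where
  open Signature Σ

  data Term : Set where
    app : (f : Fun) → Vec Term (farity f) → Term

  record Atom : Set where
    constructor _⦅_⦆
    field
      pred : Pred
      args : Vec Term (parity pred)

  data Formula : Set where
    atom : Atom → Formula
    ⊤f ⊥f : Formula
    ¬f_ : Formula → Formula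
    _∧f_ _∨f_ : Formula → Formula → Formula

  data Pol : Set where
    + - : Pol

  flip : Pol → Pol
  flip + = -
  flip - = +

  -- lit(F): ⟨A , pol⟩ ∈ lit(F) iff Occ F A pol (relative to polarity
  -- of the surrounding position, starting with +).
  data OccAt : Pol → Formula → Atom → Pol → Set where
    here  : ∀ {p A} → OccAt p (atom A) A p
    neg   : ∀ {p H A q} → OccAt (flip p) H A q → OccAt p (¬f H) A q
    andl  : ∀ {p H K A q} → OccAt p H A q → OccAt p (H ∧f K) A q
    andr  : ∀ {p H K A q} → OccAt p K A q → OccAt p (H ∧f K) A q
    orl   : ∀ {p H K A q} → OccAt p H A q → OccAt p (H ∨f K) A q
    orr   : ∀ {p H K A q} → OccAt p K A q → OccAt p (H ∨f K) A q

  InLit : Atom → Pol → Formula → Set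
  InLit A q H = OccAt + H A q

  record Literal : Set where
    constructor lit
    field
      sign : Pol
      at   : Atom

  compl : Literal → Literal
  compl (lit s A) = lit (flip s) A

  Clause : Set
  Clause = List Literal

  Clausal : Set
  Clausal = List Clause

  litF : Literal → Formula
  litF (lit + A) = atom A
  litF (lit - A) = ¬f atom A

  ⋁ : List Formula → Formula
  ⋁ []           = ⊥f
  ⋁ (H ∷ [])     = H
  ⋁ (H ∷ K ∷ Hs) = H ∨f ⋁ (K ∷ Hs)

  ⋀ : List Formula → Formula
  ⋀ []           = ⊤f
  ⋀ (H ∷ [])     = H
  ⋀ (H ∷ K ∷ Hs) = H ∧f ⋀ (K ∷ Hs)

  clauseF : Clause → Formula
  clauseF C = ⋁ (map litF C)

  clausalF : Clausal → Formula
  clausalF K = ⋀ (map clauseF K)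

  -- Semantics: first-order structures (non-empty not needed for ground)

  record Structure : Set₁ where
    field
      D     : Set
      funI  : (f : Fun) → Vec D (farity f) → D
      predI : (p : Pred) → Vec D (parity p) → Bool

  module _ (M : Structure) where
    open Structure M

    mutual
      evalT : Term → D
      evalT (app f ts) = funI f (evalTs ts)

      evalTs : ∀ {n} → Vec Term n → Vec D n
      evalTs []       = []
      evalTs (t ∷ ts) = evalT t ∷ evalTs ts

    ⟦_⟧ : Formula → Bool
    ⟦ atom (p ⦅ ts ⦆) ⟧ = predI p (evalTs ts)
    ⟦ ⊤f ⟧ = true
    ⟦ ⊥f ⟧ = false
    ⟦ ¬f H ⟧ = not ⟦ H ⟧
    ⟦ H ∧f K ⟧ = ⟦ H ⟧ ∧ ⟦ K ⟧
    ⟦ H ∨f K ⟧ = ⟦ H ⟧ ∨ ⟦ K ⟧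

  _⊨_ : Formula → Formula → Set₁
  H ⊨ K = (M : Structure) → ⟦ M ⟧ H ≡ true → ⟦ M ⟧ K ≡ true

  data Side : Set where
    𝔽 𝔾 : Side

  module Tableaux (F G : Clausal) where

    clausesOf : Side → Clausal
    clausesOf 𝔽 = F
    clausesOf 𝔾 = G

    -- A branch context: the labels and sides of the (non-root) ancestors,
    -- nearest first.
    Ctx : Set
    Ctx = List (Literal × Side)

    -- An inner
    -- node has n ≥ 1 children of a common side s', whose labels form a
    -- clause of the formula of side s' (for ground clauses, "instance of"
    -- is identity).
    mutual
      data Node (anc : Ctx) : Literal → Side → Set where
        leaf  : ∀ {L s} → (tgt : Any (λ q → proj₁ q ≡ compl L) anc) →
                Node anc L s
        inner : ∀ {L s} (s' : Side) (L₀ : Literal) (C : Clause) →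
                (L₀ ∷ C) ∈ clausesOf s' →
                Kids ((L , s) ∷ anc) s' (L₀ ∷ C) → Node anc L s

      data Kids (anc : Ctx) (s' : Side) : Clause → Set where
        []  : Kids anc s' []
        _∷_ : ∀ {L C} → Node anc L s' → Kids anc s' C → Kids anc s' (L ∷ C)

    -- A leaf-closed two-sided ground tableau, given by the children of its
    -- (unlabelled) root.  The root must have children (a childless root
    -- would be a non-closing leaf).
    record Tableau : Set where
      constructor root
      field
        side₀ : Side
        L₀    : Literal
        C₀    : Clause
        cl₀   : (L₀ ∷ C₀) ∈ clausesOf side₀
        kids₀ : Kids [] side₀ (L₀ ∷ C₀)

    tgtSide : ∀ {anc : Ctx} {P : Literal × Side → Set} → Any P anc → Side
    tgtSide {(_ , s) ∷ _} (Any.here _)  = s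
    tgtSide {_ ∷ _}       (Any.there t) = tgtSide t

    combine : Side → List Formula → Formula
    combine 𝔽 = ⋁
    combine 𝔾 = ⋀

    leafIpol : Side → Side → Literal → Formula
    leafIpol 𝔽 𝔽 L = ⊥f
    leafIpol 𝔽 𝔾 L = litF L
    leafIpol 𝔾 𝔽 L = litF (compl L)
    leafIpol 𝔾 𝔾 L = ⊤f

    mutual
      ipol : ∀ {anc L s} → Node anc L s → Formula
      ipol {L = L} {s} (leaf t) = leafIpol s (tgtSide t) L
      ipol (inner s' _ _ _ ks)  = combine s' (ipols ks)

      ipols : ∀ {anc s' C} → Kids anc s' C → List Formula
      ipols []       = []
      ipols (N ∷ ks) = ipol N ∷ ipols ks

    ipolRoot : Tableau → Formula
    ipolRoot (root s _ _ _ ks) = combine s (ipols ks)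

-- Let M be a model of the clauses of side s₀ and suppose every literal of side s₀
-- on the branch above a node is true in M.  Then ipol of the node is true in M if
-- s₀ = F and false if s₀ = G: a leaf whose literal and target both lie on side s₀
-- would put complementary true literals on the branch; a mixed leaf contributes
-- the literal that is true (resp. false); children on side s₀ include one with a
-- true literal, since their clause holds in M; and children on the other side
-- meet the hypothesis vacuously.  For the literals, every branch literal of side
-- s occurs in the formula of side s, and a mixed leaf contributes a literal of F
-- whose complement is a literal of G, hence a literal of ¬G.
module Submission where

open import Defs
open import Data.Bool using (Bool; true; false; not; _∨_)
open import Data.Bool.Properties using (not-involutive; ∨-zeroʳ; ∧-zeroʳ; ∧-conicalˡ; ∧-conicalʳ)
open import Data.Empty using (⊥; ⊥-elim)
open import Data.List using ([]; _∷_; map)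
open import Data.List.Membership.Propositional using (_∈_)
open import Data.List.Membership.Propositional.Properties using (∈-map⁺)
open import Data.List.Relation.Unary.All as All using (All; []; _∷_)
import Data.List.Relation.Unary.All.Properties as All
open import Data.List.Relation.Unary.Any using (Any; here; there)
import Data.List.Relation.Unary.Any.Properties as Any
open import Data.Product using (_×_; _,_; proj₁)
open import Data.Sum using (_⊎_; inj₁; inj₂; [_,_])
open import Function using (_∘_)
open import Relation.Binary.Definitions using (DecidableEquality)
open import Relation.Binary.PropositionalEquality using (_≡_; _≢_; refl; sym; trans; cong)
open import Relation.Nullary using (yes; no)

∨-true⁻ : ∀ a b → a ∨ b ≡ true → a ≡ true ⊎ b ≡ true
∨-true⁻ true  b _ = inj₁ refl
∨-true⁻ false b e = inj₂ e

module Interpolation (S : Signature) where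
  open FOL S
  open Literal

  flip-OccAt : ∀ {p H A q} → OccAt p H A q → OccAt (flip p) H A (flip q)
  flip-OccAt here     = here
  flip-OccAt (neg o)  = neg (flip-OccAt o)
  flip-OccAt (andl o) = andl (flip-OccAt o)
  flip-OccAt (andr o) = andr (flip-OccAt o)
  flip-OccAt (orl o)  = orl (flip-OccAt o)
  flip-OccAt (orr o)  = orr (flip-OccAt o)

  ⋁-OccAt⁺ : ∀ {p H A q} Hs → H ∈ Hs → OccAt p H A q → OccAt p (⋁ Hs) A q
  ⋁-OccAt⁺ (H ∷ [])     (here refl) o = o
  ⋁-OccAt⁺ (H ∷ K ∷ Hs) (here refl) o = orl o
  ⋁-OccAt⁺ (H ∷ K ∷ Hs) (there m)   o = orr (⋁-OccAt⁺ (K ∷ Hs) m o)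

  ⋀-OccAt⁺ : ∀ {p H A q} Hs → H ∈ Hs → OccAt p H A q → OccAt p (⋀ Hs) A q
  ⋀-OccAt⁺ (H ∷ [])     (here refl) o = o
  ⋀-OccAt⁺ (H ∷ K ∷ Hs) (here refl) o = andl o
  ⋀-OccAt⁺ (H ∷ K ∷ Hs) (there m)   o = andr (⋀-OccAt⁺ (K ∷ Hs) m o)

  ⋁-OccAt⁻ : ∀ {p A q} Hs → OccAt p (⋁ Hs) A q → Any (λ H → OccAt p H A q) Hs
  ⋁-OccAt⁻ (H ∷ [])     o       = here o
  ⋁-OccAt⁻ (H ∷ K ∷ Hs) (orl o) = here o
  ⋁-OccAt⁻ (H ∷ K ∷ Hs) (orr o) = there (⋁-OccAt⁻ (K ∷ Hs) o)

  ⋀-OccAt⁻ : ∀ {p A q} Hs → OccAt p (⋀ Hs) A q → Any (λ H → OccAt p H A q) Hs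
  ⋀-OccAt⁻ (H ∷ [])     o        = here o
  ⋀-OccAt⁻ (H ∷ K ∷ Hs) (andl o) = here o
  ⋀-OccAt⁻ (H ∷ K ∷ Hs) (andr o) = there (⋀-OccAt⁻ (K ∷ Hs) o)

  InLit-litF : ∀ L → InLit (at L) (sign L) (litF L)
  InLit-litF (lit + A) = here
  InLit-litF (lit - A) = neg here

  InLit-clausalF : ∀ {K C L} → C ∈ K → L ∈ C → InLit (at L) (sign L) (clausalF K)
  InLit-clausalF {K} {C} {L} C∈K L∈C =
    ⋀-OccAt⁺ (map clauseF K) (∈-map⁺ clauseF C∈K)
      (⋁-OccAt⁺ (map litF C) (∈-map⁺ litF L∈C) (InLit-litF L))

  ⊨¬-intro : ∀ {H K} → (∀ M → ⟦ M ⟧ K ≡ true → ⟦ M ⟧ H ≡ false) → H ⊨ (¬f K)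
  ⊨¬-intro {H} {K} H-false M H-true with ⟦ M ⟧ K in K-value
  ... | true  with () ← trans (sym H-true) (H-false M K-value)
  ... | false = refl

  module _ (M : Structure) where

    ⋁-true⁺ : ∀ Hs → Any (λ H → ⟦ M ⟧ H ≡ true) Hs → ⟦ M ⟧ (⋁ Hs) ≡ true
    ⋁-true⁺ (H ∷ [])     (here e)  = e
    ⋁-true⁺ (H ∷ K ∷ Hs) (here e)  rewrite e = refl
    ⋁-true⁺ (H ∷ K ∷ Hs) (there a) rewrite ⋁-true⁺ (K ∷ Hs) a = ∨-zeroʳ _

    ⋁-true⁻ : ∀ Hs → ⟦ M ⟧ (⋁ Hs) ≡ true → Any (λ H → ⟦ M ⟧ H ≡ true) Hs
    ⋁-true⁻ (H ∷ [])     e = here e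
    ⋁-true⁻ (H ∷ K ∷ Hs) e = [ here , there ∘ ⋁-true⁻ (K ∷ Hs) ] (∨-true⁻ (⟦ M ⟧ H) _ e)

    ⋁-false⁺ : ∀ Hs → All (λ H → ⟦ M ⟧ H ≡ false) Hs → ⟦ M ⟧ (⋁ Hs) ≡ false
    ⋁-false⁺ []           []              = refl
    ⋁-false⁺ (H ∷ [])     (e ∷ [])        = e
    ⋁-false⁺ (H ∷ K ∷ Hs) (e ∷ es) rewrite e = ⋁-false⁺ (K ∷ Hs) es

    ⋀-true⁺ : ∀ Hs → All (λ H → ⟦ M ⟧ H ≡ true) Hs → ⟦ M ⟧ (⋀ Hs) ≡ true
    ⋀-true⁺ []           []              = refl
    ⋀-true⁺ (H ∷ [])     (e ∷ [])        = e
    ⋀-true⁺ (H ∷ K ∷ Hs) (e ∷ es) rewrite e = ⋀-true⁺ (K ∷ Hs) es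

    ⋀-true⁻ : ∀ Hs → ⟦ M ⟧ (⋀ Hs) ≡ true → All (λ H → ⟦ M ⟧ H ≡ true) Hs
    ⋀-true⁻ []           e = []
    ⋀-true⁻ (H ∷ [])     e = e ∷ []
    ⋀-true⁻ (H ∷ K ∷ Hs) e =
      ∧-conicalˡ _ _ e ∷ ⋀-true⁻ (K ∷ Hs) (∧-conicalʳ (⟦ M ⟧ H) _ e)

    ⋀-false⁺ : ∀ Hs → Any (λ H → ⟦ M ⟧ H ≡ false) Hs → ⟦ M ⟧ (⋀ Hs) ≡ false
    ⋀-false⁺ (H ∷ [])     (here e)  = e
    ⋀-false⁺ (H ∷ K ∷ Hs) (here e)  rewrite e = refl
    ⋀-false⁺ (H ∷ K ∷ Hs) (there a) rewrite ⋀-false⁺ (K ∷ Hs) a = ∧-zeroʳ _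

    clausalF-true⇒clause-true : ∀ {K C} → ⟦ M ⟧ (clausalF K) ≡ true → C ∈ K →
                                Any (λ L → ⟦ M ⟧ (litF L) ≡ true) C
    clausalF-true⇒clause-true {K} {C} K-true C∈K =
      Any.map⁻ (⋁-true⁻ (map litF C)
        (All.lookup (All.map⁻ (⋀-true⁻ (map clauseF K) K-true)) C∈K))

    litF-compl : ∀ L → ⟦ M ⟧ (litF (compl L)) ≡ not (⟦ M ⟧ (litF L))
    litF-compl (lit + A) = refl
    litF-compl (lit - A) = sym (not-involutive _)

    true⇒compl-false : ∀ L → ⟦ M ⟧ (litF L) ≡ true → ⟦ M ⟧ (litF (compl L)) ≡ false
    true⇒compl-false L e = trans (litF-compl L) (cong not e)

    compl-true⇒false : ∀ L → ⟦ M ⟧ (litF (compl L)) ≡ true → ⟦ M ⟧ (litF L) ≡ false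
    compl-true⇒false L e =
      trans (sym (not-involutive _)) (cong not (trans (sym (litF-compl L)) e))

    ¬both-true : ∀ L → ⟦ M ⟧ (litF L) ≡ true → ⟦ M ⟧ (litF (compl L)) ≡ true → ⊥
    ¬both-true L e e′ with () ← trans (sym e′) (true⇒compl-false L e)

  _≟ˢ_ : DecidableEquality Side
  𝔽 ≟ˢ 𝔽 = yes refl
  𝔽 ≟ˢ 𝔾 = no λ ()
  𝔾 ≟ˢ 𝔽 = no λ ()
  𝔾 ≟ˢ 𝔾 = yes refl

  -- The value ipol takes in a model of the formula of the given side.
  value : Side → Bool
  value 𝔽 = true
  value 𝔾 = false

  module _ (F G : Clausal) where
    open Tableaux F G

    All-tgt : ∀ {P : Literal × Side → Set} {anc L} → All P anc →
              (t : Any (λ e → proj₁ e ≡ compl L) anc) → P (compl L , tgtSide t)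
    All-tgt (p ∷ ps) (here refl) = p
    All-tgt (p ∷ ps) (there t)   = All-tgt ps t

    module _ (M : Structure) where

      TrueOnSide : Side → Literal × Side → Set
      TrueOnSide s₀ (L , s) = s ≡ s₀ → ⟦ M ⟧ (litF L) ≡ true

      leafIpol-value : ∀ s₀ s s′ L → TrueOnSide s₀ (L , s) → TrueOnSide s₀ (compl L , s′) →
                       ⟦ M ⟧ (leafIpol s s′ L) ≡ value s₀
      leafIpol-value 𝔽 𝔽 𝔽 L e e′ = ⊥-elim (¬both-true M L (e refl) (e′ refl))
      leafIpol-value 𝔽 𝔽 𝔾 L e e′ = e refl
      leafIpol-value 𝔽 𝔾 𝔽 L e e′ = e′ refl
      leafIpol-value 𝔽 𝔾 𝔾 L e e′ = refl
      leafIpol-value 𝔾 𝔽 𝔽 L e e′ = refl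
      leafIpol-value 𝔾 𝔽 𝔾 L e e′ = compl-true⇒false M L (e′ refl)
      leafIpol-value 𝔾 𝔾 𝔽 L e e′ = true⇒compl-false M L (e refl)
      leafIpol-value 𝔾 𝔾 𝔾 L e e′ = ⊥-elim (¬both-true M L (e refl) (e′ refl))

      combine-some : ∀ s Hs → Any (λ H → ⟦ M ⟧ H ≡ value s) Hs →
                     ⟦ M ⟧ (combine s Hs) ≡ value s
      combine-some 𝔽 = ⋁-true⁺ M
      combine-some 𝔾 = ⋀-false⁺ M

      combine-all : ∀ {s s′} Hs → s′ ≢ s → All (λ H → ⟦ M ⟧ H ≡ value s) Hs →
                    ⟦ M ⟧ (combine s′ Hs) ≡ value s
      combine-all {𝔽} {𝔽} Hs s′≢s = ⊥-elim (s′≢s refl)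
      combine-all {𝔽} {𝔾} Hs _    = ⋀-true⁺ M Hs
      combine-all {𝔾} {𝔽} Hs _    = ⋁-false⁺ M Hs
      combine-all {𝔾} {𝔾} Hs s′≢s = ⊥-elim (s′≢s refl)

      module _ (s₀ : Side) (model : ⟦ M ⟧ (clausalF (clausesOf s₀)) ≡ true) where

        mutual
          ipol-value : ∀ {anc L s} (N : Node anc L s) → All (TrueOnSide s₀) anc →
                       TrueOnSide s₀ (L , s) → ⟦ M ⟧ (ipol N) ≡ value s₀
          ipol-value {L = L} {s} (leaf t) anc-true L-true =
            leafIpol-value s₀ s (tgtSide t) L L-true (All-tgt anc-true t)
          ipol-value (inner s′ _ _ C∈ ks) anc-true L-true =
            children-value s′ C∈ ks (L-true ∷ anc-true)

          children-value : ∀ {anc L₀ C} s′ → (L₀ ∷ C) ∈ clausesOf s′ →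
                           (ks : Kids anc s′ (L₀ ∷ C)) → All (TrueOnSide s₀) anc →
                           ⟦ M ⟧ (combine s′ (ipols ks)) ≡ value s₀
          children-value s′ C∈ ks anc-true with s′ ≟ˢ s₀
          ... | yes refl = combine-some s₀ (ipols ks)
                             (some-child-value ks anc-true (clausalF-true⇒clause-true M model C∈))
          ... | no s′≢s₀ = combine-all (ipols ks) s′≢s₀ (all-children-value ks anc-true s′≢s₀)

          some-child-value : ∀ {anc C} (ks : Kids anc s₀ C) → All (TrueOnSide s₀) anc →
                             Any (λ L → ⟦ M ⟧ (litF L) ≡ true) C →
                             Any (λ H → ⟦ M ⟧ H ≡ value s₀) (ipols ks)
          some-child-value (N ∷ ks) anc-true (here e)  = here (ipol-value N anc-true (λ _ → e))
          some-child-value (N ∷ ks) anc-true (there a) = there (some-child-value ks anc-true a)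

          all-children-value : ∀ {anc s′ C} (ks : Kids anc s′ C) → All (TrueOnSide s₀) anc →
                               s′ ≢ s₀ → All (λ H → ⟦ M ⟧ H ≡ value s₀) (ipols ks)
          all-children-value []       anc-true s′≢s₀ = []
          all-children-value (N ∷ ks) anc-true s′≢s₀ =
            ipol-value N anc-true (λ s′≡s₀ → ⊥-elim (s′≢s₀ s′≡s₀))
              ∷ all-children-value ks anc-true s′≢s₀

        ipolRoot-value : (T : Tableau) → ⟦ M ⟧ (ipolRoot T) ≡ value s₀
        ipolRoot-value (root s _ _ C∈ ks) = children-value s C∈ ks []

    OccursOnSide : Literal × Side → Set
    OccursOnSide (L , s) = InLit (at L) (sign L) (clausalF (clausesOf s))

    Shared : Atom → Pol → Set
    Shared A q = InLit A q (clausalF F) × InLit A q (¬f clausalF G)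

    leafIpol-shared : ∀ s s′ L {A q} → OccursOnSide (L , s) → OccursOnSide (compl L , s′) →
                      InLit A q (leafIpol s s′ L) → Shared A q
    leafIpol-shared 𝔽 𝔾 (lit + A) inF inG here       = inF , neg (flip-OccAt inG)
    leafIpol-shared 𝔽 𝔾 (lit - A) inF inG (neg here) = inF , neg (flip-OccAt inG)
    leafIpol-shared 𝔾 𝔽 (lit + A) inG inF (neg here) = inF , neg (flip-OccAt inG)
    leafIpol-shared 𝔾 𝔽 (lit - A) inG inF here       = inF , neg (flip-OccAt inG)

    combine-InLit⁻ : ∀ {A q} s Hs → InLit A q (combine s Hs) → Any (InLit A q) Hs
    combine-InLit⁻ 𝔽 = ⋁-OccAt⁻
    combine-InLit⁻ 𝔾 = ⋀-OccAt⁻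

    clause-occurs : ∀ {s C} → C ∈ clausesOf s → All (λ L → OccursOnSide (L , s)) C
    clause-occurs C∈ = All.tabulate (InLit-clausalF C∈)

    mutual
      ipol-shared : ∀ {anc L s A q} (N : Node anc L s) → All OccursOnSide anc →
                    OccursOnSide (L , s) → InLit A q (ipol N) → Shared A q
      ipol-shared {L = L} {s} (leaf t) anc-occ L-occ o =
        leafIpol-shared s (tgtSide t) L L-occ (All-tgt anc-occ t) o
      ipol-shared (inner s′ _ _ C∈ ks) anc-occ L-occ o =
        children-shared ks (L-occ ∷ anc-occ) (clause-occurs C∈) (combine-InLit⁻ s′ _ o)

      children-shared : ∀ {anc s′ C A q} (ks : Kids anc s′ C) → All OccursOnSide anc →
                        All (λ L → OccursOnSide (L , s′)) C →
                        Any (InLit A q) (ipols ks) → Shared A q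
      children-shared (N ∷ ks) anc-occ (L-occ ∷ C-occ) (here o)  = ipol-shared N anc-occ L-occ o
      children-shared (N ∷ ks) anc-occ (L-occ ∷ C-occ) (there a) = children-shared ks anc-occ C-occ a

    ipolRoot-shared : (T : Tableau) → ∀ A q → InLit A q (ipolRoot T) → Shared A q
    ipolRoot-shared (root s _ _ C∈ ks) A q o =
      children-shared ks [] (clause-occurs C∈) (combine-InLit⁻ s _ o)

lemma1 : (S : Signature) → let open FOL S in
    (F G : Clausal) → let open Tableaux F G in
    (T : Tableau) →
    ((clausalF F ⊨ ipolRoot T) × (ipolRoot T ⊨ (¬f clausalF G)))
    × (∀ (A : Atom) (q : Pol) → InLit A q (ipolRoot T) →
    InLit A q (clausalF F) × InLit A q (¬f clausalF G))
lemma1 S F G T =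
  ( (λ M F-true → ipolRoot-value F G M 𝔽 F-true T)
  , ⊨¬-intro {ipolRoot T} {clausalF G} (λ M G-true → ipolRoot-value F G M 𝔾 G-true T) )
  , ipolRoot-shared F G T
  where
  open FOL S
  open Tableaux F G using (ipolRoot)
  open Interpolation S
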